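{- If $(e_k)_{k\ge0}$ is a $q$-Catalan basis, then for each $k$ the power series $e_k$ has order $k$ (its lowest-degree nonzero term is of degree $k$).
   Context: $q$ is a fixed parameter; all series are formal. A Catalan power series is a power series $P(z,t)$ for which there is a power series $\tilde P(z,t)$ with $P(z,t)=t-z\tilde P(z,t)t^2$. A family of power series $(e_k(z))_{k\ge0}$ is a $q$-Catalan basis if there exists a Catalan power series $P$ such that $e_k(qz)/e_k(z)=P(z,q^k)/P(z,1)$ for every nonnegative integer $k$. -}

module Defs where

open import Level using (Level; suc; _⊔_)
open import Data.Nat using (ℕ; _∸_; _<_)
import Data.Nat as N
open import Data.Product using (Σ; _×_)
open import Relation.Nullary using (¬_)
open import Algebra.Bundles using (CommutativeRing)

record Field (c ℓ : Level) : Set (suc (c ⊔ ℓ)) where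
  field
    commutativeRing : CommutativeRing c ℓ
  open CommutativeRing commutativeRing public
  field
    1≉0     : ¬ (1# ≈ 0#)
    inverse : ∀ x → ¬ (x ≈ 0#) → Σ Carrier (λ y → x * y ≈ 1#)

module FPS {c ℓ : Level} (F : Field c ℓ) where
  open Field F hiding (zero)

  -- formal power series in z: n ↦ coefficient of z^n
  Series : Set c
  Series = ℕ → Carrier

  pow : Carrier → ℕ → Carrier
  pow x N.zero     = 1#
  pow x (N.suc n) = x * pow x n

  sumTo : ℕ → (ℕ → Carrier) → Carrier
  sumTo N.zero     f = f N.zero
  sumTo (N.suc n) f = sumTo n f + f (N.suc n)

  _⊛_ : Series → Series → Series
  (f ⊛ g) n = sumTo n (λ i → f i * g (n ∸ i))

  _≋_ : Series → Series → Set ℓ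
  f ≋ g = ∀ n → f n ≈ g n

  -- f(z) ↦ f(qz)
  dilate : Carrier → Series → Series
  dilate q f n = pow q n * f n

  -- A Catalan power series P(z,t) = t - z P̃(z,t) t², where P̃ is given by its
  -- z-coefficients viewed as functions of t (P̃ₙ(t) = coefficient of zⁿ in P̃(z,t)).
  -- catalanAt P̃ t is the z-series P(z,t) for the value t.
  catalanAt : (ℕ → Carrier → Carrier) → Carrier → Series
  catalanAt P̃ t N.zero      = t
  catalanAt P̃ t (N.suc n) = - (P̃ n t * (t * t))

  NonZeroSeries : Series → Set ℓ
  NonZeroSeries f = ¬ (∀ n → f n ≈ 0#)

  -- (e_k) is a q-Catalan basis: e_k(qz)/e_k(z) = P(z,q^k)/P(z,1) for all k,
  -- for some Catalan power series P.  The quotient e_k(qz)/e_k(z) being defined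
  -- requires e_k ≠ 0; the equality of quotients is stated with denominators cleared
  -- (P(z,1) has constant term 1, so it is invertible).
  IsQCatalanBasis : Carrier → (ℕ → Series) → Set (c ⊔ ℓ)
  IsQCatalanBasis q e =
    Σ (ℕ → Carrier → Carrier) λ P̃ →
      ∀ k → NonZeroSeries (e k)
          × ((dilate q (e k) ⊛ catalanAt P̃ 1#) ≋ (catalanAt P̃ (pow q k) ⊛ e k))

  HasOrder : Series → ℕ → Set ℓ
  HasOrder f k = (∀ n → n < k → f n ≈ 0#) × ¬ (f k ≈ 0#)

module Submission where

-- Let (e_k) be a q-Catalan basis with Catalan series
-- P(z,t) = t - z P̃(z,t) t², so that  e_k(qz) P(z,1) = P(z,q^k) e_k(z).
-- Fix k and suppose the coefficients e_k,i vanish for all i < n.  Then in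
-- both Cauchy products only one term of degree n survives, and since
-- P(z,t) has constant term t, comparing z^n-coefficients gives
--     q^n e_k,n = q^k e_k,n .
-- As the powers of q are pairwise distinct, e_k,n = 0 whenever n ≠ k.
-- By induction on n this forces e_k,i = 0 for i < k, and if also
-- e_k,k = 0 then every coefficient vanishes, contradicting e_k ≠ 0.

open import Defs
open import Level using (Level)
open import Data.Nat using (ℕ; zero; suc; _≤_; _<_; _∸_; z≤n; s≤s; _≟_)
open import Data.Nat.Properties
  using (≤-refl; m≤n⇒m≤1+n; m<1+n⇒m<n∨m≡n; n∸n≡0; ∸-monoʳ-<; <-irrefl; <⇒≤)
open import Data.Product using (_,_; proj₁; proj₂)
open import Data.Sum using (inj₁; inj₂)
open import Relation.Binary.PropositionalEquality using (_≢_; cong) renaming (refl to ≡-refl)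
open import Relation.Nullary using (¬_; yes; no)
import Algebra.Properties.Ring as RingProperties
import Relation.Binary.Reasoning.Setoid as SetoidReasoning

module SeriesOrder {c ℓ : Level} (F : Field c ℓ) where
  open Field F hiding (zero)
  open FPS F
  open RingProperties ring using ([y-z]x≈yx-zx)
  open SetoidReasoning setoid

  nonzero-cancelˡ : ∀ {y x} → ¬ (y ≈ 0#) → y * x ≈ 0# → x ≈ 0#
  nonzero-cancelˡ {y} {x} y≉0 yx≈0 = begin
    x               ≈⟨ *-identityˡ x ⟨
    1# * x          ≈⟨ *-congʳ (trans (sym y*y⁻¹≈1) (*-comm y y⁻¹)) ⟩
    (y⁻¹ * y) * x   ≈⟨ *-assoc y⁻¹ y x ⟩
    y⁻¹ * (y * x)   ≈⟨ *-congˡ yx≈0 ⟩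
    y⁻¹ * 0#        ≈⟨ zeroʳ y⁻¹ ⟩
    0#              ∎
    where
    y⁻¹ = proj₁ (inverse y y≉0)
    y*y⁻¹≈1 = proj₂ (inverse y y≉0)

  distinct-cancel : ∀ {a b x} → ¬ (a ≈ b) → a * x ≈ b * x → x ≈ 0#
  distinct-cancel {a} {b} {x} a≉b ax≈bx =
    nonzero-cancelˡ a-b≉0 (trans ([y-z]x≈yx-zx x a b) (difference-zero ax≈bx))
    where
    difference-zero : ∀ {u v} → u ≈ v → u - v ≈ 0#
    difference-zero {u} {v} u≈v = trans (+-congʳ u≈v) (-‿inverseʳ v)
    a-b≉0 : ¬ (a - b ≈ 0#)
    a-b≉0 a-b≈0 = a≉b (begin
      a                 ≈⟨ +-identityʳ a ⟨
      a + 0#            ≈⟨ +-congˡ (-‿inverseˡ b) ⟨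
      a + (- b + b)     ≈⟨ +-assoc a (- b) b ⟨
      (a - b) + b       ≈⟨ +-congʳ a-b≈0 ⟩
      0# + b            ≈⟨ +-identityˡ b ⟩
      b                 ∎)

  sumTo-zero : ∀ n g → (∀ i → i ≤ n → g i ≈ 0#) → sumTo n g ≈ 0#
  sumTo-zero zero    g g≈0 = g≈0 0 z≤n
  sumTo-zero (suc n) g g≈0 = begin
    sumTo n g + g (suc n) ≈⟨ +-cong (sumTo-zero n g (λ i i≤n → g≈0 i (m≤n⇒m≤1+n i≤n)))
                                    (g≈0 (suc n) ≤-refl) ⟩
    0# + 0#               ≈⟨ +-identityˡ 0# ⟩
    0#                    ∎

  sumTo-last : ∀ n g → (∀ i → i < n → g i ≈ 0#) → sumTo n g ≈ g n
  sumTo-last zero    g g≈0 = refl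
  sumTo-last (suc n) g g≈0 = begin
    sumTo n g + g (suc n) ≈⟨ +-congʳ (sumTo-zero n g (λ i i≤n → g≈0 i (s≤s i≤n))) ⟩
    0# + g (suc n)        ≈⟨ +-identityˡ _ ⟩
    g (suc n)             ∎

  sumTo-first : ∀ n g → (∀ i → 0 < i → i ≤ n → g i ≈ 0#) → sumTo n g ≈ g 0
  sumTo-first zero    g g≈0 = refl
  sumTo-first (suc n) g g≈0 = begin
    sumTo n g + g (suc n) ≈⟨ +-cong (sumTo-first n g (λ i 0<i i≤n → g≈0 i 0<i (m≤n⇒m≤1+n i≤n)))
                                    (g≈0 (suc n) (s≤s z≤n) ≤-refl) ⟩
    g 0 + 0#              ≈⟨ +-identityʳ _ ⟩
    g 0                   ∎

  VanishesBelow : Series → ℕ → Set ℓ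
  VanishesBelow f n = ∀ i → i < n → f i ≈ 0#

  vanishesBelow-suc : ∀ {f n} → VanishesBelow f n → f n ≈ 0# → VanishesBelow f (suc n)
  vanishesBelow-suc f<n fn≈0 i i<1+n with m<1+n⇒m<n∨m≡n i<1+n
  ... | inj₁ i<n    = f<n i i<n
  ... | inj₂ ≡-refl = fn≈0

  dilate-vanishesBelow : ∀ q {f n} → VanishesBelow f n → VanishesBelow (dilate q f) n
  dilate-vanishesBelow q f<n i i<n = trans (*-congˡ (f<n i i<n)) (zeroʳ _)

  ⊛-leadingˡ : ∀ f g n → VanishesBelow f n → (f ⊛ g) n ≈ f n * g 0
  ⊛-leadingˡ f g n f<n = begin
    (f ⊛ g) n         ≈⟨ sumTo-last n _ (λ i i<n → trans (*-congʳ (f<n i i<n)) (zeroˡ _)) ⟩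
    f n * g (n ∸ n)   ≡⟨ cong (λ j → f n * g j) (n∸n≡0 n) ⟩
    f n * g 0         ∎

  ⊛-leadingʳ : ∀ f g n → VanishesBelow g n → (f ⊛ g) n ≈ f 0 * g n
  ⊛-leadingʳ f g n g<n = sumTo-first n _ later-terms-vanish
    where
    later-terms-vanish : ∀ i → 0 < i → i ≤ n → f i * g (n ∸ i) ≈ 0#
    later-terms-vanish i 0<i i≤n =
      trans (*-congˡ (g<n (n ∸ i) (∸-monoʳ-< {n} {i} {0} 0<i i≤n))) (zeroʳ _)

  module ForcedOrder (f : Series) (k : ℕ)
      (forced : ∀ n → VanishesBelow f n → n ≢ k → f n ≈ 0#) where

    vanishes-below-k : ∀ n → n ≤ k → VanishesBelow f n
    vanishes-below-k zero    _     i ()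
    vanishes-below-k (suc n) 1+n≤k =
      vanishesBelow-suc f<n (forced n f<n (λ { ≡-refl → <-irrefl ≡-refl 1+n≤k }))
      where f<n = vanishes-below-k n (<⇒≤ 1+n≤k)

    vanishes-everywhere : f k ≈ 0# → ∀ n → VanishesBelow f n
    vanishes-everywhere fk≈0 zero    i ()
    vanishes-everywhere fk≈0 (suc n) = vanishesBelow-suc f<n fn≈0
      where
      f<n = vanishes-everywhere fk≈0 n
      fn≈0 : f n ≈ 0#
      fn≈0 with n ≟ k
      ... | yes ≡-refl = fk≈0
      ... | no  n≢k    = forced n f<n n≢k

    hasOrder : NonZeroSeries f → HasOrder f k
    hasOrder f≉0 =
      vanishes-below-k k ≤-refl ,
      λ fk≈0 → f≉0 (λ n → vanishes-everywhere fk≈0 (suc n) n ≤-refl)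

  -- Coefficient comparison in e(qz) P(z,1) = P(z,q^k) e(z): if e vanishes below
  -- n, the z^n-coefficients are q^n e_n · 1 and q^k e_n, since P(z,t) has
  -- constant term t.
  catalan-leading : ∀ q (P̃ : ℕ → Carrier → Carrier) k (e : Series)
    → (dilate q e ⊛ catalanAt P̃ 1#) ≋ (catalanAt P̃ (pow q k) ⊛ e)
    → ∀ n → VanishesBelow e n → pow q n * e n ≈ pow q k * e n
  catalan-leading q P̃ k e eqn n e<n = begin
    pow q n * e n                      ≈⟨ *-identityʳ _ ⟨
    dilate q e n * 1#                  ≈⟨ ⊛-leadingˡ (dilate q e) (catalanAt P̃ 1#) n (dilate-vanishesBelow q e<n) ⟨
    (dilate q e ⊛ catalanAt P̃ 1#) n    ≈⟨ eqn n ⟩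
    (catalanAt P̃ (pow q k) ⊛ e) n      ≈⟨ ⊛-leadingʳ (catalanAt P̃ (pow q k)) e n e<n ⟩
    pow q k * e n                      ∎

lemma2p3 : {c ℓ : Level} (F : Field c ℓ) (q : Field.Carrier F)
    → (∀ m n → m ≢ n → ¬ (Field._≈_ F (FPS.pow F q m) (FPS.pow F q n)))
    → (e : ℕ → FPS.Series F)
    → FPS.IsQCatalanBasis F q e
    → ∀ k → FPS.HasOrder F (e k) k
lemma2p3 F q powers-distinct e (P̃ , basis) k = hasOrder nonzero
  where
  open SeriesOrder F
  nonzero = proj₁ (basis k)
  equation = proj₂ (basis k)
  forced : ∀ n → VanishesBelow (e k) n → n ≢ k → Field._≈_ F (e k n) (Field.0# F)
  forced n e<n n≢k =
    distinct-cancel (powers-distinct n k n≢k) (catalan-leading q P̃ k (e k) equation n e<n)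
  open ForcedOrder (e k) k forced
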